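{- Let $q$ be a prime power and let $m_1,n_1,m_2,n_2\in\{1,\dots,q-1\}$. If the digraphs $D(q;m_1,n_1)$ and $D(q;m_2,n_2)$ are isomorphic, then the bipartite graphs $G(q;m_1,n_1)$ and $G(q;m_2,n_2)$ are isomorphic, and $\{\gcd(m_1,q-1),\gcd(n_1,q-1)\}=\{\gcd(m_2,q-1),\gcd(n_2,q-1)\}$ as multisets.
   Context: $\mathbb{F}_q$ is the field with $q$ elements. For integers $1\le m,n\le q-1$, the monomial digraph $D(q;m,n)$ has vertex set $\mathbb{F}_q^2$, and $((x_1,x_2),(y_1,y_2))$ is an arc iff $x_2+y_2=x_1^m y_1^n$ (loops allowed). The bipartite graph $G(q;m,n)$ has two parts $P$ and $L$, each a copy of $\mathbb{F}_q^2$, and $(p_1,p_2)\in P$ is adjacent to $(l_1,l_2)\in L$ iff $p_2+l_2=p_1^m l_1^n$. -}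

module Defs where

open import Level using (Level; Lift)
open import Data.Empty using (⊥)
open import Data.Nat as ℕ using (ℕ; zero; suc; _≤_; _∸_)
open import Data.Nat.Primality using (Prime)
open import Data.Fin using (Fin)
open import Data.Product using (Σ; ∃; _×_; _,_; proj₁; proj₂)
open import Data.Sum using (_⊎_; inj₁; inj₂)
open import Relation.Nullary using (¬_)
open import Relation.Binary.PropositionalEquality using (_≡_)
open import Algebra.Structures using (IsCommutativeRing)
open import Function.Bundles using (_↔_; _⇔_; Inverse)

IsPrimePower : ℕ → Set
IsPrimePower q = Σ ℕ λ p → Σ ℕ λ k → Prime p × 1 ≤ k × q ≡ p ℕ.^ k

record Field (c : Level) : Set (Level.suc c) where
  field
    Carrier : Set c
    _+_ _*_ : Carrier → Carrier → Carrier
    -_      : Carrier → Carrier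
    0# 1#   : Carrier
    isCommutativeRing : IsCommutativeRing _≡_ _+_ _*_ -_ 0# 1#
    0≢1     : ¬ (0# ≡ 1#)
    _⁻¹     : Carrier → Carrier
    ⁻¹-inverse : ∀ x → ¬ (x ≡ 0#) → x * (x ⁻¹) ≡ 1#
  infixl 6 _+_
  infixl 7 _*_

  _^_ : Carrier → ℕ → Carrier
  x ^ zero = 1#
  x ^ suc n = x * (x ^ n)
  infixr 8 _^_

record FiniteField (c : Level) (q : ℕ) : Set (Level.suc c) where
  field
    field′      : Field c
    cardinality : Fin q ↔ Field.Carrier field′
  open Field field′ public

module _ {c : Level} {q : ℕ} (F : FiniteField c q) where
  open FiniteField F

  Pt : Set c
  Pt = Carrier × Carrier

  DArc : ℕ → ℕ → Pt → Pt → Set c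
  DArc m n (x₁ , x₂) (y₁ , y₂) = x₂ + y₂ ≡ (x₁ ^ m) * (y₁ ^ n)

  -- vertex set of the bipartite graph G(q;m,n): P ⊎ L, each a copy of 𝔽_q²
  GVertex : Set c
  GVertex = Pt ⊎ Pt

  GAdj : ℕ → ℕ → GVertex → GVertex → Set c
  GAdj m n (inj₁ p) (inj₂ l) = DArc m n p l
  GAdj m n (inj₂ l) (inj₁ p) = DArc m n p l
  GAdj m n (inj₁ _) (inj₁ _) = Lift c ⊥
  GAdj m n (inj₂ _) (inj₂ _) = Lift c ⊥

  DIsomorphic : ℕ → ℕ → ℕ → ℕ → Set c
  DIsomorphic m₁ n₁ m₂ n₂ =
    Σ (Pt ↔ Pt) λ φ → ∀ x y → DArc m₁ n₁ x y ⇔ DArc m₂ n₂ (Inverse.to φ x) (Inverse.to φ y)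

  -- G(q;m₁,n₁) ≅ G(q;m₂,n₂) as (undirected) graphs: a bijection of vertex sets
  -- preserving adjacency in both directions (parts may be swapped)
  GIsomorphic : ℕ → ℕ → ℕ → ℕ → Set c
  GIsomorphic m₁ n₁ m₂ n₂ =
    Σ (GVertex ↔ GVertex) λ φ → ∀ u v → GAdj m₁ n₁ u v ⇔ GAdj m₂ n₂ (Inverse.to φ u) (Inverse.to φ v)

SameMultiset₂ : ℕ → ℕ → ℕ → ℕ → Set
SameMultiset₂ a₁ b₁ a₂ b₂ = (a₁ ≡ a₂ × b₁ ≡ b₂) ⊎ (a₁ ≡ b₂ × b₁ ≡ a₂)

-- For n ≥ 1, two vertices (a, b) and (a′, b′) of D(q;m,n) have the same out-neighbourhood iff b = b′
-- and aᵐ = a′ᵐ. Such a class is therefore in bijection with a fibre of x ↦ xᵐ, of size 1 or |μₘ|,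
-- the number of m-th roots of unity, and the class of (1, 0) has size exactly |μₘ|. An isomorphism
-- D(q;m₁,n₁) ≅ D(q;m₂,n₂) maps classes into classes, so |μ_{m₁}| ≤ |μ_{m₂}|, and equality holds by
-- symmetry; reversing every arc exchanges the roles of m and n. It remains that |μₘ| = gcd(m, q − 1):
-- by Fermat and Bézout, μₘ = μ_d for d = gcd(m, q − 1), and for d ∣ q − 1 the root bound applied to
-- xᵈ − 1 gives |μ_d| ≤ d, while applied to (x^(q−1) − 1)/(xᵈ − 1) it gives |μ_d| ≥ d. The bipartite
-- graphs are isomorphic through the same bijection acting on both parts.

module Submission where

open import Defs
open import Level using (Level)
open import Data.Nat as ℕ using (ℕ; zero; suc; _≤_; _∸_; z≤n; s≤s)
import Data.Nat.Properties as ℕ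
open import Data.Nat.GCD using (gcd; gcd[m,n]∣m; gcd[m,n]∣n; gcd-GCD; module Bézout)
open import Data.Nat.Divisibility using (_∣_; divides)
open import Data.Product using (_×_; _,_; proj₁; proj₂)
open import Data.Sum using (_⊎_; inj₁; inj₂)
open import Data.Sum.Function.Propositional using (_⊎-cong_)
open import Data.Maybe using (nothing)
import Data.Fin.Properties as Fin
open import Data.List using (List; []; _∷_; _++_; map; filter; length; replicate; foldr; tabulate)
import Data.List.Properties as List
open import Data.List.Membership.Propositional using (_∈_)
open import Data.List.Membership.Propositional.Properties
  using (∈-++⁺ˡ; ∈-++⁺ʳ; ∈-++⁻; ∈-∃++; ∈-map⁺; ∈-map⁻; ∈-filter⁺; ∈-filter⁻; ∈-tabulate⁺)
open import Data.List.Membership.Propositional.Properties.WithK using (unique∧set⇒bag)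
open import Data.List.Relation.Binary.Subset.Propositional using (_⊆_)
open import Data.List.Relation.Binary.BagAndSetEquality using (∼bag⇒↭)
open import Data.List.Relation.Binary.Permutation.Propositional using (_↭_; ↭⇒↭ₛ)
import Data.List.Relation.Binary.Permutation.Setoid.Properties as Permutation
open import Data.List.Relation.Unary.All as All using (All; []; _∷_)
import Data.List.Relation.Unary.All.Properties as All
open import Data.List.Relation.Unary.Any using (here; there)
open import Data.List.Relation.Unary.AllPairs using ([]; _∷_)
open import Data.List.Relation.Unary.Unique.Propositional using (Unique)
import Data.List.Relation.Unary.Unique.Propositional.Properties as Unique
open import Relation.Nullary using (yes; no; ¬?; contradiction)
open import Relation.Nullary.Decidable using (via-injection)
open import Relation.Unary using (Pred; Decidable; _≐_)
open import Relation.Binary.Definitions using (DecidableEquality)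
open import Relation.Binary.PropositionalEquality
open import Function.Bundles using (Inverse; Injection; _↔_; _⇔_; Equivalence; mk⇔)
open import Function.Properties.Inverse using (↔⇒↣)
open import Function.Construct.Symmetry using (↔-sym; ⇔-sym)
open import Function.Construct.Composition using (_⇔-∘_)
open import Algebra.Bundles using (AbelianGroup; CommutativeRing)
open import Algebra.Structures using (IsCommutativeRing)
open import Tactic.RingSolver.Core.AlmostCommutativeRing using (AlmostCommutativeRing; fromCommutativeRing)

module _ {a} {A : Set a} where

  ∈-++-removeMiddle : ∀ ys₁ {ys₂ : List A} {x z} → z ∈ ys₁ ++ x ∷ ys₂ → z ≢ x → z ∈ ys₁ ++ ys₂
  ∈-++-removeMiddle ys₁ z∈ys z≢x with ∈-++⁻ ys₁ z∈ys
  ... | inj₁ z∈ys₁          = ∈-++⁺ˡ z∈ys₁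
  ... | inj₂ (here z≡x)     = contradiction z≡x z≢x
  ... | inj₂ (there z∈ys₂)  = ∈-++⁺ʳ ys₁ z∈ys₂

  Unique-⊆⇒length≤ : ∀ {xs ys : List A} → Unique xs → xs ⊆ ys → length xs ≤ length ys
  Unique-⊆⇒length≤ {[]}     _             _     = z≤n
  Unique-⊆⇒length≤ {x ∷ xs} (x∉xs ∷ xs!) xs⊆ys with ∈-∃++ (xs⊆ys (here refl))
  ... | ys₁ , ys₂ , refl =
    ℕ.≤-trans (s≤s (Unique-⊆⇒length≤ xs! xs⊆ys₁++ys₂))
              (ℕ.≤-reflexive (sym (List.length-++-sucʳ ys₁ x ys₂)))
    where
    xs⊆ys₁++ys₂ : xs ⊆ ys₁ ++ ys₂
    xs⊆ys₁++ys₂ z∈xs =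
      ∈-++-removeMiddle ys₁ (xs⊆ys (there z∈xs)) (λ z≡x → All.lookup x∉xs z∈xs (sym z≡x))

  Unique-map⁺-injectiveOn : ∀ {b} {B : Set b} (f : A → B) {xs} → Unique xs →
    (∀ {x y} → x ∈ xs → y ∈ xs → f x ≡ f y → x ≡ y) → Unique (map f xs)
  Unique-map⁺-injectiveOn f {[]}     []            _   = []
  Unique-map⁺-injectiveOn f {x ∷ xs} (x∉xs ∷ xs!) inj =
    All.map⁺ (All.tabulate λ y∈xs fx≡fy → All.lookup x∉xs y∈xs (inj (here refl) (there y∈xs) fx≡fy))
    ∷ Unique-map⁺-injectiveOn f xs! (λ x∈ y∈ → inj (there x∈) (there y∈))

module FieldArithmetic {c : Level} {q : ℕ} (F : FiniteField c q) where
  open FiniteField F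
  open IsCommutativeRing isCommutativeRing public
    using (+-assoc; +-comm; +-identityˡ; +-identityʳ; -‿inverseˡ; -‿inverseʳ;
           *-assoc; *-comm; *-identityˡ; *-identityʳ; zeroˡ; zeroʳ; *-isCommutativeMonoid)

  commutativeRing : CommutativeRing c c
  commutativeRing = record { isCommutativeRing = isCommutativeRing }

  open CommutativeRing commutativeRing using (+-abelianGroup; *-commutativeSemigroup)
  open import Algebra.Properties.AbelianGroup +-abelianGroup public using (xyx⁻¹≈y)
  open import Algebra.Properties.Group (AbelianGroup.group +-abelianGroup) public
    using (x∙y⁻¹≈ε⇒x≈y; ∙-cancelˡ)
  open import Algebra.Properties.CommutativeSemigroup *-commutativeSemigroup public using (interchange)

  almostCommutativeRing : AlmostCommutativeRing c c
  almostCommutativeRing = fromCommutativeRing commutativeRing (λ _ → nothing)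
  open import Tactic.RingSolver.NonReflective almostCommutativeRing public using (solve; _⊜_; _⊕_; _⊗_; Κ)

  infix 4 _≟_
  _≟_ : DecidableEquality Carrier
  _≟_ = via-injection (↔⇒↣ (↔-sym cardinality)) Fin._≟_

  *-cancelʳ-≢0 : ∀ {x y z} → z ≢ 0# → x * z ≡ y * z → x ≡ y
  *-cancelʳ-≢0 {x} {y} {z} z≢0 xz≡yz = begin
    x                 ≡⟨ sym (*-identityʳ x) ⟩
    x * 1#            ≡⟨ cong (x *_) (sym (⁻¹-inverse z z≢0)) ⟩
    x * (z * z ⁻¹)    ≡⟨ sym (*-assoc x z (z ⁻¹)) ⟩
    x * z * z ⁻¹      ≡⟨ cong (_* z ⁻¹) xz≡yz ⟩
    y * z * z ⁻¹      ≡⟨ *-assoc y z (z ⁻¹) ⟩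
    y * (z * z ⁻¹)    ≡⟨ cong (y *_) (⁻¹-inverse z z≢0) ⟩
    y * 1#            ≡⟨ *-identityʳ y ⟩
    y                 ∎
    where open ≡-Reasoning

  x*y≡0⇒x≡0∨y≡0 : ∀ {x y} → x * y ≡ 0# → x ≡ 0# ⊎ y ≡ 0#
  x*y≡0⇒x≡0∨y≡0 {x} {y} xy≡0 with y ≟ 0#
  ... | yes y≡0 = inj₂ y≡0
  ... | no  y≢0 = inj₁ (*-cancelʳ-≢0 y≢0 (trans xy≡0 (sym (zeroˡ y))))

  x≢0∧y≢0⇒x*y≢0 : ∀ {x y} → x ≢ 0# → y ≢ 0# → x * y ≢ 0#
  x≢0∧y≢0⇒x*y≢0 x≢0 y≢0 xy≡0 with x*y≡0⇒x≡0∨y≡0 xy≡0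
  ... | inj₁ x≡0 = x≢0 x≡0
  ... | inj₂ y≡0 = y≢0 y≡0

  ⁻¹-≢0 : ∀ {x} → x ≢ 0# → x ⁻¹ ≢ 0#
  ⁻¹-≢0 {x} x≢0 x⁻¹≡0 = 0≢1 (trans (sym (zeroʳ x)) (trans (cong (x *_) (sym x⁻¹≡0)) (⁻¹-inverse x x≢0)))

  ^-homo-* : ∀ x m n → x ^ (m ℕ.+ n) ≡ x ^ m * x ^ n
  ^-homo-* x zero    n = sym (*-identityˡ (x ^ n))
  ^-homo-* x (suc m) n = trans (cong (x *_) (^-homo-* x m n)) (sym (*-assoc x (x ^ m) (x ^ n)))

  ^-assocʳ : ∀ x m n → (x ^ m) ^ n ≡ x ^ (m ℕ.* n)
  ^-assocʳ x m zero    = cong (x ^_) (sym (ℕ.*-zeroʳ m))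
  ^-assocʳ x m (suc n) = begin
    x ^ m * (x ^ m) ^ n      ≡⟨ cong (x ^ m *_) (^-assocʳ x m n) ⟩
    x ^ m * x ^ (m ℕ.* n)    ≡⟨ sym (^-homo-* x m (m ℕ.* n)) ⟩
    x ^ (m ℕ.+ m ℕ.* n)      ≡⟨ cong (x ^_) (sym (ℕ.*-suc m n)) ⟩
    x ^ (m ℕ.* suc n)        ∎
    where open ≡-Reasoning

  ^-distribʳ-* : ∀ x y n → (x * y) ^ n ≡ x ^ n * y ^ n
  ^-distribʳ-* x y zero    = sym (*-identityˡ 1#)
  ^-distribʳ-* x y (suc n) = trans (cong (x * y *_) (^-distribʳ-* x y n)) (interchange x y (x ^ n) (y ^ n))

  1^n≡1 : ∀ n → 1# ^ n ≡ 1#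
  1^n≡1 zero    = refl
  1^n≡1 (suc n) = trans (*-identityˡ (1# ^ n)) (1^n≡1 n)

  0^n≡0 : ∀ {n} → 1 ≤ n → 0# ^ n ≡ 0#
  0^n≡0 {suc n} _ = zeroˡ (0# ^ n)

  x^n≡0⇒x≡0 : ∀ {x} n → x ^ n ≡ 0# → x ≡ 0#
  x^n≡0⇒x≡0 zero    1≡0  = contradiction (sym 1≡0) 0≢1
  x^n≡0⇒x≡0 (suc n) xxⁿ≡0 with x*y≡0⇒x≡0∨y≡0 xxⁿ≡0
  ... | inj₁ x≡0  = x≡0
  ... | inj₂ xⁿ≡0 = x^n≡0⇒x≡0 n xⁿ≡0

  x^n≡1⇒x^kn≡1 : ∀ {x} n k → x ^ n ≡ 1# → x ^ (k ℕ.* n) ≡ 1#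
  x^n≡1⇒x^kn≡1 {x} n k xⁿ≡1 = begin
    x ^ (k ℕ.* n)   ≡⟨ cong (x ^_) (ℕ.*-comm k n) ⟩
    x ^ (n ℕ.* k)   ≡⟨ sym (^-assocʳ x n k) ⟩
    (x ^ n) ^ k     ≡⟨ cong (_^ k) xⁿ≡1 ⟩
    1# ^ k          ≡⟨ 1^n≡1 k ⟩
    1#              ∎
    where open ≡-Reasoning

  x^m+n≡1⇒x^m≡1 : ∀ {x} m n → x ^ (m ℕ.+ n) ≡ 1# → x ^ n ≡ 1# → x ^ m ≡ 1#
  x^m+n≡1⇒x^m≡1 {x} m n x^m+n≡1 xⁿ≡1 = begin
    x ^ m            ≡⟨ sym (*-identityʳ (x ^ m)) ⟩
    x ^ m * 1#       ≡⟨ cong (x ^ m *_) (sym xⁿ≡1) ⟩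
    x ^ m * x ^ n    ≡⟨ sym (^-homo-* x m n) ⟩
    x ^ (m ℕ.+ n)    ≡⟨ x^m+n≡1 ⟩
    1#               ∎
    where open ≡-Reasoning

module Counting {c : Level} {q : ℕ} (F : FiniteField c q) where
  open FiniteField F
  open FieldArithmetic F

  elements : List Carrier
  elements = tabulate (Inverse.to cardinality)

  ∈-elements : ∀ x → x ∈ elements
  ∈-elements x = subst (_∈ elements) (Inverse.strictlyInverseˡ cardinality x)
    (∈-tabulate⁺ (Inverse.from cardinality x))

  elements-Unique : Unique elements
  elements-Unique = Unique.tabulate⁺ (Injection.injective (↔⇒↣ cardinality))

  length-elements : length elements ≡ q
  length-elements = List.length-tabulate (Inverse.to cardinality)

  count : ∀ {P : Pred Carrier c} → Decidable P → ℕ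
  count P? = length (filter P? elements)

  Unique⇒length≤count : ∀ {P : Pred Carrier c} (P? : Decidable P) {xs} → Unique xs → All P xs →
    length xs ≤ count P?
  Unique⇒length≤count P? xs! Pxs =
    Unique-⊆⇒length≤ xs! (λ x∈xs → ∈-filter⁺ P? (∈-elements _) (All.lookup Pxs x∈xs))

  module _ {P Q : Pred Carrier c} (P? : Decidable P) (Q? : Decidable Q) where

    count-cong : P ≐ Q → count P? ≡ count Q?
    count-cong P≐Q = cong length (List.filter-≐ P? Q? P≐Q elements)

    count-≤-injection : (f : Carrier → Carrier) → (∀ {x} → P x → Q (f x)) →
      (∀ {x y} → P x → P y → f x ≡ f y → x ≡ y) → count P? ≤ count Q?
    count-≤-injection f P⇒Qf injective = subst (_≤ count Q?) (List.length-map f (filter P? elements))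
      (Unique⇒length≤count Q? (Unique-map⁺-injectiveOn f (Unique.filter⁺ P? elements-Unique) injectiveOnP)
        (All.map⁺ (All.map P⇒Qf (All.all-filter P? elements))))
      where
      injectiveOnP : ∀ {x y} → x ∈ filter P? elements → y ∈ filter P? elements → f x ≡ f y → x ≡ y
      injectiveOnP x∈ y∈ =
        injective (proj₂ (∈-filter⁻ P? {xs = elements} x∈)) (proj₂ (∈-filter⁻ P? {xs = elements} y∈))

    count-≤-+ : ∀ {R : Pred Carrier c} (R? : Decidable R) → (∀ {x} → P x → Q x ⊎ R x) →
      count P? ≤ count Q? ℕ.+ count R?
    count-≤-+ R? P⇒Q∨R = subst (count P? ≤_) (List.length-++ (filter Q? elements))
      (Unique-⊆⇒length≤ (Unique.filter⁺ P? elements-Unique) P⊆Q++R)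
      where
      P⊆Q++R : filter P? elements ⊆ filter Q? elements ++ filter R? elements
      P⊆Q++R {x} x∈ with P⇒Q∨R (proj₂ (∈-filter⁻ P? {xs = elements} x∈))
      ... | inj₁ Qx = ∈-++⁺ˡ (∈-filter⁺ Q? (∈-elements x) Qx)
      ... | inj₂ Rx = ∈-++⁺ʳ (filter Q? elements) (∈-filter⁺ R? (∈-elements x) Rx)

module Units {c : Level} {q : ℕ} (F : FiniteField c q) where
  open FiniteField F
  open FieldArithmetic F
  open Counting F

  nonzero? : Decidable (_≢ 0#)
  nonzero? x = ¬? (x ≟ 0#)

  units : List Carrier
  units = filter nonzero? elements

  units-Unique : Unique units
  units-Unique = Unique.filter⁺ nonzero? elements-Unique

  ∈-units⁺ : ∀ {x} → x ≢ 0# → x ∈ units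
  ∈-units⁺ {x} = ∈-filter⁺ nonzero? (∈-elements x)

  ∈-units⁻ : ∀ {x} → x ∈ units → x ≢ 0#
  ∈-units⁻ x∈ = proj₂ (∈-filter⁻ nonzero? {xs = elements} x∈)

  length-0∷units≡q : length (0# ∷ units) ≡ q
  length-0∷units≡q = trans (ℕ.≤-antisym 0∷units≤elements elements≤0∷units) length-elements
    where
    0∷units≤elements : length (0# ∷ units) ≤ length elements
    0∷units≤elements = Unique-⊆⇒length≤ (All.tabulate (λ x∈ 0≡x → ∈-units⁻ x∈ (sym 0≡x)) ∷ units-Unique)
      (λ {x} _ → ∈-elements x)
    elements≤0∷units : length elements ≤ length (0# ∷ units)
    elements≤0∷units = Unique-⊆⇒length≤ elements-Unique λ {x} _ → zero-or-unit x
      where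
      zero-or-unit : ∀ x → x ∈ 0# ∷ units
      zero-or-unit x with x ≟ 0#
      ... | yes x≡0 = here x≡0
      ... | no  x≢0 = there (∈-units⁺ x≢0)

  length-units≡q∸1 : length units ≡ q ∸ 1
  length-units≡q∸1 = cong (_∸ 1) length-0∷units≡q

  1≤q∸1 : 1 ≤ q ∸ 1
  1≤q∸1 = subst (1 ≤_) length-units≡q∸1
    (Unique⇒length≤count nonzero? (All.[] ∷ []) ((λ 1≡0 → 0≢1 (sym 1≡0)) ∷ []))

  product : List Carrier → Carrier
  product = foldr _*_ 1#

  product-≢0 : ∀ {xs} → All (_≢ 0#) xs → product xs ≢ 0#
  product-≢0 []           = λ 1≡0 → 0≢1 (sym 1≡0)
  product-≢0 (x≢0 ∷ xs≢0) = x≢0∧y≢0⇒x*y≢0 x≢0 (product-≢0 xs≢0)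

  product-map-* : ∀ u xs → product (map (u *_) xs) ≡ u ^ length xs * product xs
  product-map-* u []       = sym (*-identityˡ 1#)
  product-map-* u (x ∷ xs) =
    trans (cong (u * x *_) (product-map-* u xs)) (interchange u x (u ^ length xs) (product xs))

  map-*-units↭units : ∀ {u} → u ≢ 0# → map (u *_) units ↭ units
  map-*-units↭units {u} u≢0 = ∼bag⇒↭ (unique∧set⇒bag
    (Unique.map⁺ (λ ux≡uy → *-cancelʳ-≢0 u≢0 (trans (*-comm _ u) (trans ux≡uy (*-comm u _)))) units-Unique)
    units-Unique (mk⇔ into onto))
    where
    into : ∀ {y} → y ∈ map (u *_) units → y ∈ units
    into y∈ with ∈-map⁻ (u *_) y∈
    ... | x , x∈ , refl = ∈-units⁺ (x≢0∧y≢0⇒x*y≢0 u≢0 (∈-units⁻ x∈))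
    onto : ∀ {y} → y ∈ units → y ∈ map (u *_) units
    onto {y} y∈ = subst (_∈ map (u *_) units) u*u⁻¹y≡y
      (∈-map⁺ (u *_) (∈-units⁺ (x≢0∧y≢0⇒x*y≢0 (⁻¹-≢0 u≢0) (∈-units⁻ y∈))))
      where
      u*u⁻¹y≡y : u * (u ⁻¹ * y) ≡ y
      u*u⁻¹y≡y = trans (sym (*-assoc u (u ⁻¹) y)) (trans (cong (_* y) (⁻¹-inverse u u≢0)) (*-identityˡ y))

  fermat : ∀ {u} → u ≢ 0# → u ^ (q ∸ 1) ≡ 1#
  fermat {u} u≢0 = subst (λ n → u ^ n ≡ 1#) length-units≡q∸1
    (*-cancelʳ-≢0 (product-≢0 (All.tabulate ∈-units⁻)) (begin
      u ^ length units * product units    ≡⟨ sym (product-map-* u units) ⟩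
      product (map (u *_) units)          ≡⟨ Permutation.foldr-commMonoid (setoid Carrier) *-isCommutativeMonoid
                                               (↭⇒↭ₛ (map-*-units↭units u≢0)) ⟩
      product units                       ≡⟨ sym (*-identityˡ (product units)) ⟩
      1# * product units                  ∎))
    where open ≡-Reasoning

module MonicPolynomials {c : Level} {q : ℕ} (F : FiniteField c q) where
  open FiniteField F
  open FieldArithmetic F
  open Counting F

  -- The coefficient list c₀ ∷ … ∷ cₙ₋₁ stands for the monic polynomial c₀ + c₁x + … + cₙ₋₁xⁿ⁻¹ + xⁿ.
  monic : List Carrier → Carrier → Carrier
  monic []       x = 1#
  monic (a ∷ cs) x = a + x * monic cs x

  monic-shift : ∀ j cs x → monic (replicate j 0# ++ cs) x ≡ x ^ j * monic cs x
  monic-shift zero    cs x = sym (*-identityˡ (monic cs x))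
  monic-shift (suc j) cs x = begin
    0# + x * monic (replicate j 0# ++ cs) x   ≡⟨ +-identityˡ _ ⟩
    x * monic (replicate j 0# ++ cs) x        ≡⟨ cong (x *_) (monic-shift j cs x) ⟩
    x * (x ^ j * monic cs x)                  ≡⟨ sym (*-assoc x (x ^ j) (monic cs x)) ⟩
    x * x ^ j * monic cs x                    ∎
    where open ≡-Reasoning

  -- quotient cs r is the quotient of a ∷ cs by x − r, whatever the constant term a.
  quotient : List Carrier → Carrier → List Carrier
  quotient []       r = []
  quotient (b ∷ cs) r = monic (b ∷ cs) r ∷ quotient cs r

  length-quotient : ∀ cs r → length (quotient cs r) ≡ length cs
  length-quotient []       r = refl
  length-quotient (b ∷ cs) r = cong suc (length-quotient cs r)

  -- p(x) = (x − r) Q(x) + p(r), with the subtraction moved across.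
  monic-division : ∀ a cs r x →
    monic (a ∷ cs) x + r * monic (quotient cs r) x ≡ x * monic (quotient cs r) x + monic (a ∷ cs) r
  monic-division a []       r x =
    solve 3 (λ a x r → (a ⊕ x ⊗ Κ 1# ⊕ r ⊗ Κ 1#) ⊜ (x ⊗ Κ 1# ⊕ (a ⊕ r ⊗ Κ 1#))) refl a x r
  monic-division a (b ∷ cs) r x = begin
    a + x * P x + r * (P r + x * Q)    ≡⟨ solve 6 (λ a x r Px Pr Q →
                                            (a ⊕ x ⊗ Px ⊕ r ⊗ (Pr ⊕ x ⊗ Q)) ⊜ (a ⊕ r ⊗ Pr ⊕ x ⊗ (Px ⊕ r ⊗ Q)))
                                            refl a x r (P x) (P r) Q ⟩
    a + r * P r + x * (P x + r * Q)    ≡⟨ cong (λ t → a + r * P r + x * t) (monic-division b cs r x) ⟩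
    a + r * P r + x * (x * Q + P r)    ≡⟨ solve 5 (λ a x r Pr Q →
                                            (a ⊕ r ⊗ Pr ⊕ x ⊗ (x ⊗ Q ⊕ Pr)) ⊜ (x ⊗ (Pr ⊕ x ⊗ Q) ⊕ (a ⊕ r ⊗ Pr)))
                                            refl a x r (P r) Q ⟩
    x * (P r + x * Q) + (a + r * P r)  ∎
    where
    open ≡-Reasoning
    P : Carrier → Carrier
    P = monic (b ∷ cs)
    Q : Carrier
    Q = monic (quotient cs r) x

  roots≤degree : ∀ cs {rs} → Unique rs → All (λ r → monic cs r ≡ 0#) rs → length rs ≤ length cs
  roots≤degree cs       {[]}     _             _              = z≤n
  roots≤degree []       {r ∷ rs} _             (1≡0 ∷ _)      = contradiction (sym 1≡0) 0≢1
  roots≤degree (a ∷ cs) {r ∷ rs} (r∉rs ∷ rs!) (pr≡0 ∷ prs≡0) =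
    s≤s (subst (length rs ≤_) (length-quotient cs r)
      (roots≤degree (quotient cs r) rs! (All.tabulate root-of-quotient)))
    where
    root-of-quotient : ∀ {z} → z ∈ rs → monic (quotient cs r) z ≡ 0#
    root-of-quotient {z} z∈rs with monic (quotient cs r) z ≟ 0#
    ... | yes Qz≡0 = Qz≡0
    ... | no  Qz≢0 = contradiction (*-cancelʳ-≢0 Qz≢0 rQz≡zQz) (All.lookup r∉rs z∈rs)
      where
      open ≡-Reasoning
      Qz = monic (quotient cs r) z
      rQz≡zQz : r * Qz ≡ z * Qz
      rQz≡zQz = begin
        r * Qz                          ≡⟨ sym (+-identityˡ (r * Qz)) ⟩
        0# + r * Qz                     ≡⟨ cong (_+ r * Qz) (sym (All.lookup prs≡0 z∈rs)) ⟩
        monic (a ∷ cs) z + r * Qz       ≡⟨ monic-division a cs r z ⟩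
        z * Qz + monic (a ∷ cs) r       ≡⟨ cong (z * Qz +_) pr≡0 ⟩
        z * Qz + 0#                     ≡⟨ +-identityʳ (z * Qz) ⟩
        z * Qz                          ∎

  root? : ∀ cs → Decidable (λ x → monic cs x ≡ 0#)
  root? cs x = monic cs x ≟ 0#

  count-roots≤degree : ∀ cs → count (root? cs) ≤ length cs
  count-roots≤degree cs =
    roots≤degree cs (Unique.filter⁺ (root? cs) elements-Unique) (All.all-filter (root? cs) elements)

module RootsOfUnity {c : Level} {q : ℕ} (F : FiniteField c q) where
  open FiniteField F
  open FieldArithmetic F
  open Counting F
  open Units F
  open MonicPolynomials F

  μ? : ∀ m → Decidable (λ x → x ^ m ≡ 1#)
  μ? m x = x ^ m ≟ 1#

  #μ : ℕ → ℕ
  #μ m = count (μ? m)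

  -- unity d stands for x^(d+1) − 1.
  unity : ℕ → List Carrier
  unity d = - 1# ∷ (replicate d 0# ++ [])

  #μ≤ : ∀ d → #μ (suc d) ≤ suc d
  #μ≤ d = ℕ.≤-trans (count-≤-injection (μ? (suc d)) (root? (unity d)) (λ x → x) root (λ _ _ x≡y → x≡y))
    (subst (count (root? (unity d)) ≤_) length-unity (count-roots≤degree (unity d)))
    where
    open ≡-Reasoning
    root : ∀ {x} → x ^ suc d ≡ 1# → monic (unity d) x ≡ 0#
    root {x} x^d+1≡1 = begin
      - 1# + x * monic (replicate d 0# ++ []) x   ≡⟨ cong (λ t → - 1# + x * t) (monic-shift d [] x) ⟩
      - 1# + x * (x ^ d * 1#)                     ≡⟨ cong (λ t → - 1# + x * t) (*-identityʳ (x ^ d)) ⟩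
      - 1# + x ^ suc d                            ≡⟨ cong (- 1# +_) x^d+1≡1 ⟩
      - 1# + 1#                                   ≡⟨ -‿inverseˡ 1# ⟩
      0#                                          ∎
    length-unity : length (unity d) ≡ suc d
    length-unity =
      cong suc (trans (List.length-++ (replicate d 0#)) (trans (ℕ.+-identityʳ _) (List.length-replicate d)))

  -- geometric d k stands for 1 + w + w² + … + wᵏ with w = x^(d+1).
  geometric : ℕ → ℕ → List Carrier
  geometric d zero    = []
  geometric d (suc k) = 1# ∷ (replicate d 0# ++ geometric d k)

  length-geometric : ∀ d k → length (geometric d k) ≡ k ℕ.* suc d
  length-geometric d zero    = refl
  length-geometric d (suc k) =
    cong suc (trans (List.length-++ (replicate d 0#)) (cong₂ ℕ._+_ (List.length-replicate d) (length-geometric d k)))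

  -- (w − 1)(1 + w + … + wᵏ) = wᵏ⁺¹ − 1, with the subtractions moved across.
  geometric-sum : ∀ d k x → let w = x ^ suc d; G = monic (geometric d k) x in w ^ suc k + G ≡ w * G + 1#
  geometric-sum d zero    x = refl
  geometric-sum d (suc k) x = begin
    w * w ^ suc k + monic (geometric d (suc k)) x   ≡⟨ cong (w * w ^ suc k +_) monic-geometric ⟩
    w * w ^ suc k + (1# + w * G)                    ≡⟨ solve 3 (λ w W G →
                                                         (w ⊗ W ⊕ (Κ 1# ⊕ w ⊗ G)) ⊜ (Κ 1# ⊕ w ⊗ (W ⊕ G)))
                                                         refl w (w ^ suc k) G ⟩
    1# + w * (w ^ suc k + G)                        ≡⟨ cong (λ t → 1# + w * t) (geometric-sum d k x) ⟩
    1# + w * (w * G + 1#)                           ≡⟨ solve 2 (λ w G →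
                                                         (Κ 1# ⊕ w ⊗ (w ⊗ G ⊕ Κ 1#)) ⊜ (w ⊗ (Κ 1# ⊕ w ⊗ G) ⊕ Κ 1#))
                                                         refl w G ⟩
    w * (1# + w * G) + 1#                           ≡⟨ cong (λ t → w * t + 1#) monic-geometric ⟨
    w * monic (geometric d (suc k)) x + 1#          ∎
    where
    open ≡-Reasoning
    w = x ^ suc d
    G = monic (geometric d k) x
    monic-geometric : monic (geometric d (suc k)) x ≡ 1# + w * G
    monic-geometric =
      cong (1# +_) (trans (cong (x *_) (monic-shift d (geometric d k) x)) (sym (*-assoc x (x ^ d) G)))

  unit⇒μ⊎geometric-root : ∀ d k → q ∸ 1 ≡ suc k ℕ.* suc d → ∀ {x} → x ≢ 0# →
    x ^ suc d ≡ 1# ⊎ monic (geometric d k) x ≡ 0#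
  unit⇒μ⊎geometric-root d k q∸1≡kd {x} x≢0 with G ≟ 0#
    where G = monic (geometric d k) x
  ... | yes G≡0 = inj₂ G≡0
  ... | no  G≢0 = inj₁ (sym (*-cancelʳ-≢0 G≢0 (trans (*-identityˡ G) G≡wG)))
    where
    open ≡-Reasoning
    w = x ^ suc d
    G = monic (geometric d k) x
    wᵏ⁺¹≡1 : w ^ suc k ≡ 1#
    wᵏ⁺¹≡1 = trans (^-assocʳ x (suc d) (suc k))
      (trans (cong (x ^_) (trans (ℕ.*-comm (suc d) (suc k)) (sym q∸1≡kd))) (fermat x≢0))
    G≡wG : G ≡ w * G
    G≡wG = ∙-cancelˡ 1# G (w * G) (begin
      1# + G          ≡⟨ cong (_+ G) wᵏ⁺¹≡1 ⟨
      w ^ suc k + G   ≡⟨ geometric-sum d k x ⟩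
      w * G + 1#      ≡⟨ +-comm (w * G) 1# ⟩
      1# + w * G      ∎)

  ≤#μ : ∀ d k → q ∸ 1 ≡ suc k ℕ.* suc d → suc d ≤ #μ (suc d)
  ≤#μ d k q∸1≡kd = ℕ.+-cancelʳ-≤ (k ℕ.* suc d) (suc d) (#μ (suc d)) (begin
    suc d ℕ.+ k ℕ.* suc d                               ≡⟨ sym q∸1≡kd ⟩
    q ∸ 1                                               ≡⟨ sym length-units≡q∸1 ⟩
    count nonzero?                                      ≤⟨ count-≤-+ nonzero? (μ? (suc d)) (root? (geometric d k))
                                                             (unit⇒μ⊎geometric-root d k q∸1≡kd) ⟩
    #μ (suc d) ℕ.+ count (root? (geometric d k))        ≤⟨ ℕ.+-monoʳ-≤ (#μ (suc d))
                                                             (count-roots≤degree (geometric d k)) ⟩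
    #μ (suc d) ℕ.+ length (geometric d k)               ≡⟨ cong (#μ (suc d) ℕ.+_) (length-geometric d k) ⟩
    #μ (suc d) ℕ.+ k ℕ.* suc d                          ∎)
    where open ℕ.≤-Reasoning

  #μ-divisor : ∀ {d} → d ∣ q ∸ 1 → #μ d ≡ d
  #μ-divisor {suc d} (divides (suc k) q∸1≡kd) = ℕ.≤-antisym (#μ≤ d) (≤#μ d k q∸1≡kd)
  #μ-divisor {suc d} (divides zero    q∸1≡0)  = contradiction q∸1≡0 (ℕ.n>0⇒n≢0 1≤q∸1)
  #μ-divisor {zero}  (divides k       q∸1≡0)  = contradiction (trans q∸1≡0 (ℕ.*-zeroʳ k)) (ℕ.n>0⇒n≢0 1≤q∸1)

  x^m≡1⇔x^gcd≡1 : ∀ {m} → 1 ≤ m → (λ x → x ^ m ≡ 1#) ≐ (λ x → x ^ gcd m (q ∸ 1) ≡ 1#)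
  x^m≡1⇔x^gcd≡1 {m} 1≤m = x^m≡1⇒x^g≡1 , x^g≡1⇒x^m≡1
    where
    g = gcd m (q ∸ 1)
    x^g≡1⇒x^m≡1 : ∀ {x} → x ^ g ≡ 1# → x ^ m ≡ 1#
    x^g≡1⇒x^m≡1 {x} x^g≡1 with gcd[m,n]∣m m (q ∸ 1)
    ... | divides t m≡tg = trans (cong (x ^_) m≡tg) (x^n≡1⇒x^kn≡1 g t x^g≡1)
    x^m≡1⇒x≢0 : ∀ {x} → x ^ m ≡ 1# → x ≢ 0#
    x^m≡1⇒x≢0 x^m≡1 refl = 0≢1 (trans (sym (0^n≡0 1≤m)) x^m≡1)
    x^m≡1⇒x^g≡1 : ∀ {x} → x ^ m ≡ 1# → x ^ g ≡ 1#
    x^m≡1⇒x^g≡1 {x} x^m≡1 = from-bézout (Bézout.identity (gcd-GCD m (q ∸ 1)))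
      where
      x^im≡1 : ∀ i → x ^ (i ℕ.* m) ≡ 1#
      x^im≡1 i = x^n≡1⇒x^kn≡1 m i x^m≡1
      x^j[q∸1]≡1 : ∀ j → x ^ (j ℕ.* (q ∸ 1)) ≡ 1#
      x^j[q∸1]≡1 j = x^n≡1⇒x^kn≡1 (q ∸ 1) j (fermat (x^m≡1⇒x≢0 x^m≡1))
      from-bézout : Bézout.Identity g m (q ∸ 1) → x ^ g ≡ 1#
      from-bézout (Bézout.+- i j g+j[q∸1]≡im) =
        x^m+n≡1⇒x^m≡1 g _ (trans (cong (x ^_) g+j[q∸1]≡im) (x^im≡1 i)) (x^j[q∸1]≡1 j)
      from-bézout (Bézout.-+ i j g+im≡j[q∸1]) =
        x^m+n≡1⇒x^m≡1 g _ (trans (cong (x ^_) g+im≡j[q∸1]) (x^j[q∸1]≡1 j)) (x^im≡1 i)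

  #μ≡gcd : ∀ {m} → 1 ≤ m → #μ m ≡ gcd m (q ∸ 1)
  #μ≡gcd {m} 1≤m = trans (count-cong (μ? m) (μ? (gcd m (q ∸ 1))) (x^m≡1⇔x^gcd≡1 1≤m))
                         (#μ-divisor (gcd[m,n]∣n m (q ∸ 1)))

  fibre? : ∀ m a → Decidable (λ x → x ^ m ≡ a ^ m)
  fibre? m a x = x ^ m ≟ a ^ m

  count-fibre≤#μ : ∀ {m} → 1 ≤ m → ∀ a → count (fibre? m a) ≤ #μ m
  count-fibre≤#μ {m} 1≤m a with a ≟ 0#
  ... | yes refl = count-≤-injection (fibre? m 0#) (μ? m) (λ _ → 1#) (λ _ → 1^n≡1 m)
                     (λ x^m≡0 y^m≡0 _ → trans (x≡0 x^m≡0) (sym (x≡0 y^m≡0)))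
    where
    x≡0 : ∀ {x} → x ^ m ≡ 0# ^ m → x ≡ 0#
    x≡0 x^m≡0^m = x^n≡0⇒x≡0 m (trans x^m≡0^m (0^n≡0 1≤m))
  ... | no  a≢0  = count-≤-injection (fibre? m a) (μ? m) (_* a ⁻¹) into (λ _ _ → *-cancelʳ-≢0 (⁻¹-≢0 a≢0))
    where
    open ≡-Reasoning
    into : ∀ {x} → x ^ m ≡ a ^ m → (x * a ⁻¹) ^ m ≡ 1#
    into {x} x^m≡a^m = begin
      (x * a ⁻¹) ^ m       ≡⟨ ^-distribʳ-* x (a ⁻¹) m ⟩
      x ^ m * a ⁻¹ ^ m     ≡⟨ cong (_* a ⁻¹ ^ m) x^m≡a^m ⟩
      a ^ m * a ⁻¹ ^ m     ≡⟨ ^-distribʳ-* a (a ⁻¹) m ⟨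
      (a * a ⁻¹) ^ m       ≡⟨ cong (_^ m) (⁻¹-inverse a a≢0) ⟩
      1# ^ m               ≡⟨ 1^n≡1 m ⟩
      1#                   ∎

module MonomialDigraph {c : Level} {q : ℕ} (F : FiniteField c q) where
  open FiniteField F
  open FieldArithmetic F
  open Counting F
  open RootsOfUnity F

  DArc-transpose : ∀ m n x y → DArc F m n x y ⇔ DArc F n m y x
  DArc-transpose m n (x₁ , x₂) (y₁ , y₂) = mk⇔ swap swap
    where
    swap : ∀ {u v w z} → u + v ≡ w * z → v + u ≡ z * w
    swap u+v≡wz = trans (+-comm _ _) (trans u+v≡wz (*-comm _ _))

  DIsomorphic-sym : ∀ m₁ n₁ m₂ n₂ → DIsomorphic F m₁ n₁ m₂ n₂ → DIsomorphic F m₂ n₂ m₁ n₁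
  DIsomorphic-sym m₁ n₁ m₂ n₂ (φ , φ-arc) = ↔-sym φ , λ x y →
    subst₂ (λ x′ y′ → DArc F m₂ n₂ x′ y′ ⇔ DArc F m₁ n₁ (from x) (from y))
      (strictlyInverseˡ x) (strictlyInverseˡ y) (⇔-sym (φ-arc (from x) (from y)))
    where open Inverse φ

  DIsomorphic-transpose : ∀ m₁ n₁ m₂ n₂ → DIsomorphic F m₁ n₁ m₂ n₂ → DIsomorphic F n₁ m₁ n₂ m₂
  DIsomorphic-transpose m₁ n₁ m₂ n₂ (φ , φ-arc) = φ , λ x y →
    DArc-transpose m₂ n₂ _ _ ⇔-∘ (φ-arc y x ⇔-∘ DArc-transpose n₁ m₁ x y)

  DIsomorphic⇒GIsomorphic : ∀ m₁ n₁ m₂ n₂ → DIsomorphic F m₁ n₁ m₂ n₂ → GIsomorphic F m₁ n₁ m₂ n₂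
  DIsomorphic⇒GIsomorphic m₁ n₁ m₂ n₂ (φ , φ-arc) = φ⊎φ , adjacency
    where
    φ⊎φ : GVertex F ↔ GVertex F
    φ⊎φ = φ ⊎-cong φ
    adjacency : ∀ u v → GAdj F m₁ n₁ u v ⇔ GAdj F m₂ n₂ (Inverse.to φ⊎φ u) (Inverse.to φ⊎φ v)
    adjacency (inj₁ p) (inj₂ l) = φ-arc p l
    adjacency (inj₂ l) (inj₁ p) = φ-arc p l
    adjacency (inj₁ _) (inj₁ _) = mk⇔ (λ x → x) (λ x → x)
    adjacency (inj₂ _) (inj₂ _) = mk⇔ (λ x → x) (λ x → x)

  SameOutNeighbours : ℕ → ℕ → Pt F → Pt F → Set c
  SameOutNeighbours m n x x′ = ∀ y → DArc F m n x y ⇔ DArc F m n x′ y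

  sameOutNeighbours⁺ : ∀ m n {a a′} b → a ^ m ≡ a′ ^ m → SameOutNeighbours m n (a , b) (a′ , b)
  sameOutNeighbours⁺ m n b a^m≡a′^m (y₁ , y₂) =
    mk⇔ (λ arc → trans arc (cong (_* y₁ ^ n) a^m≡a′^m)) (λ arc → trans arc (cong (_* y₁ ^ n) (sym a^m≡a′^m)))

  -- Test against the targets (0, −b) and (1, aᵐ − b).
  sameOutNeighbours⁻ : ∀ m n {a b a′ b′} → 1 ≤ n → SameOutNeighbours m n (a , b) (a′ , b′) →
    b′ ≡ b × a ^ m ≡ a′ ^ m
  sameOutNeighbours⁻ m n {a} {b} {a′} {b′} 1≤n same = b′≡b , a^m≡a′^m
    where
    times0ⁿ : ∀ t → t * 0# ^ n ≡ 0#
    times0ⁿ t = trans (cong (t *_) (0^n≡0 1≤n)) (zeroʳ t)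
    times1ⁿ : ∀ t → t * 1# ^ n ≡ t
    times1ⁿ t = trans (cong (t *_) (1^n≡1 n)) (*-identityʳ t)
    b′≡b : b′ ≡ b
    b′≡b = x∙y⁻¹≈ε⇒x≈y b′ b
      (trans (Equivalence.to (same (0# , - b)) (trans (-‿inverseʳ b) (sym (times0ⁿ (a ^ m))))) (times0ⁿ (a′ ^ m)))
    b+[c-b]≡c : ∀ c → b + (c + - b) ≡ c
    b+[c-b]≡c c = trans (sym (+-assoc b c (- b))) (xyx⁻¹≈y b c)
    a^m≡a′^m : a ^ m ≡ a′ ^ m
    a^m≡a′^m = begin
      a ^ m                     ≡⟨ b+[c-b]≡c (a ^ m) ⟨
      b + (a ^ m + - b)         ≡⟨ cong (_+ (a ^ m + - b)) b′≡b ⟨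
      b′ + (a ^ m + - b)        ≡⟨ Equivalence.to (same (1# , a ^ m + - b))
                                     (trans (b+[c-b]≡c (a ^ m)) (sym (times1ⁿ (a ^ m)))) ⟩
      a′ ^ m * 1# ^ n           ≡⟨ times1ⁿ (a′ ^ m) ⟩
      a′ ^ m                    ∎
      where open ≡-Reasoning

  DIsomorphic⇒sameOutNeighbours : ∀ m₁ n₁ m₂ n₂ ((φ , _) : DIsomorphic F m₁ n₁ m₂ n₂) → ∀ {x x′} →
    SameOutNeighbours m₁ n₁ x x′ → SameOutNeighbours m₂ n₂ (Inverse.to φ x) (Inverse.to φ x′)
  DIsomorphic⇒sameOutNeighbours m₁ n₁ m₂ n₂ (φ , φ-arc) {x} {x′} same y =
    subst (λ y′ → DArc F m₂ n₂ (to x) y′ ⇔ DArc F m₂ n₂ (to x′) y′) (strictlyInverseˡ y)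
      (φ-arc x′ (from y) ⇔-∘ (same (from y) ⇔-∘ ⇔-sym (φ-arc x (from y))))
    where open Inverse φ

  -- u ↦ φ(u, 0) sends the out-neighbourhood class of (1, 0) injectively into that of φ(1, 0).
  #μ-mono : ∀ m₁ n₁ m₂ n₂ → 1 ≤ m₂ → 1 ≤ n₂ → DIsomorphic F m₁ n₁ m₂ n₂ → #μ m₁ ≤ #μ m₂
  #μ-mono m₁ n₁ m₂ n₂ 1≤m₂ 1≤n₂ iso@(φ , _) =
    ℕ.≤-trans (count-≤-injection (μ? m₁) (fibre? m₂ a*) (λ u → proj₁ (ψ u)) into injective)
              (count-fibre≤#μ 1≤m₂ a*)
    where
    ψ : Carrier → Pt F
    ψ u = Inverse.to φ (u , 0#)
    a* = proj₁ (ψ 1#)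
    same-class : ∀ {u} → u ^ m₁ ≡ 1# → proj₂ (ψ u) ≡ proj₂ (ψ 1#) × a* ^ m₂ ≡ proj₁ (ψ u) ^ m₂
    same-class u^m₁≡1 = sameOutNeighbours⁻ m₂ n₂ 1≤n₂
      (DIsomorphic⇒sameOutNeighbours m₁ n₁ m₂ n₂ iso
        (sameOutNeighbours⁺ m₁ n₁ 0# (trans (1^n≡1 m₁) (sym u^m₁≡1))))
    into : ∀ {u} → u ^ m₁ ≡ 1# → proj₁ (ψ u) ^ m₂ ≡ a* ^ m₂
    into u^m₁≡1 = sym (proj₂ (same-class u^m₁≡1))
    injective : ∀ {u v} → u ^ m₁ ≡ 1# → v ^ m₁ ≡ 1# → proj₁ (ψ u) ≡ proj₁ (ψ v) → u ≡ v
    injective u^m₁≡1 v^m₁≡1 ψu₁≡ψv₁ = cong proj₁ (Injection.injective (↔⇒↣ φ)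
      (cong₂ _,_ ψu₁≡ψv₁ (trans (proj₁ (same-class u^m₁≡1)) (sym (proj₁ (same-class v^m₁≡1))))))

  DIsomorphic⇒gcd≡ : ∀ m₁ n₁ m₂ n₂ → 1 ≤ m₁ → 1 ≤ n₁ → 1 ≤ m₂ → 1 ≤ n₂ → DIsomorphic F m₁ n₁ m₂ n₂ →
    gcd m₁ (q ∸ 1) ≡ gcd m₂ (q ∸ 1)
  DIsomorphic⇒gcd≡ m₁ n₁ m₂ n₂ 1≤m₁ 1≤n₁ 1≤m₂ 1≤n₂ iso = begin
    gcd m₁ (q ∸ 1)   ≡⟨ #μ≡gcd 1≤m₁ ⟨
    #μ m₁            ≡⟨ ℕ.≤-antisym (#μ-mono m₁ n₁ m₂ n₂ 1≤m₂ 1≤n₂ iso)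
                                         (#μ-mono m₂ n₂ m₁ n₁ 1≤m₁ 1≤n₁ (DIsomorphic-sym m₁ n₁ m₂ n₂ iso)) ⟩
    #μ m₂            ≡⟨ #μ≡gcd 1≤m₂ ⟩
    gcd m₂ (q ∸ 1)   ∎
    where open ≡-Reasoning

proposition3 : {c : Level} (q : ℕ) → IsPrimePower q → (F : FiniteField c q) →
    (m₁ n₁ m₂ n₂ : ℕ) →
    1 ≤ m₁ → m₁ ≤ q ∸ 1 → 1 ≤ n₁ → n₁ ≤ q ∸ 1 →
    1 ≤ m₂ → m₂ ≤ q ∸ 1 → 1 ≤ n₂ → n₂ ≤ q ∸ 1 →
    DIsomorphic F m₁ n₁ m₂ n₂ →
    GIsomorphic F m₁ n₁ m₂ n₂
      × SameMultiset₂ (gcd m₁ (q ∸ 1)) (gcd n₁ (q ∸ 1)) (gcd m₂ (q ∸ 1)) (gcd n₂ (q ∸ 1))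
proposition3 q _ F m₁ n₁ m₂ n₂ 1≤m₁ _ 1≤n₁ _ 1≤m₂ _ 1≤n₂ _ iso =
  DIsomorphic⇒GIsomorphic m₁ n₁ m₂ n₂ iso ,
  inj₁ ( DIsomorphic⇒gcd≡ m₁ n₁ m₂ n₂ 1≤m₁ 1≤n₁ 1≤m₂ 1≤n₂ iso
       , DIsomorphic⇒gcd≡ n₁ m₁ n₂ m₂ 1≤n₁ 1≤m₁ 1≤n₂ 1≤m₂ (DIsomorphic-transpose m₁ n₁ m₂ n₂ iso))
  where open MonomialDigraph F
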